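{- Let $S$ be a numerical semigroup and let $I,I'$ be proper maximum sparse ideals of $S$ with leaders $\lambda_i,\lambda_{i'}$ respectively. The following are equivalent: (1) $I'\supseteq I$; (2) $\lambda_i-\lambda_{i'}\in S$; (3) $S\setminus I'\subseteq S\setminus I$; (4) $\#(S\setminus I)-\#(S\setminus I')\in S$.
   Context: A numerical semigroup $S$ is a subset of $\mathbb{N}_0$ containing $0$, closed under addition, with finite complement. Its elements in increasing order are $\lambda_0=0<\lambda_1<\lambda_2<\cdots$; the genus is $g=\#(\mathbb{N}_0\setminus S)$. An ideal of $S$ is a subset $I\subseteq S$ with $I+S\subseteq I$; it is proper if $I\neq S$. The Frobenius number of an ideal $I$ is the largest integer not in $I$. It is known that it is at most $2g-1+\#(S\setminus I)$; ideals attaining this bound are called maximum sparse. For $i\ge 0$ let $D(i)=\{\lambda_j\in S:\lambda_i-\lambda_j\in S\}$ and let $G(i)$ be the number of pairs of gaps (elements of $\mathbb{N}_0\setminus S$) adding up to $\lambda_i$. It is known that a proper ideal $I$ is maximum sparse if and only if $I=S\setminus D(i)$ for some $i$ with $G(i)=0$; in this case $\lambda_i$ is called the leader of $I$. -}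

module Defs where

open import Data.Nat using (ℕ; zero; suc; _+_; _*_; _∸_; _≤_; _<_; _≤ᵇ_)
open import Data.Bool using (Bool; true; false; _∧_; not; if_then_else_)
open import Data.Product using (Σ; _×_; _,_; ∃; ∃-syntax)
open import Relation.Binary.PropositionalEquality using (_≡_)

Subset : Set
Subset = ℕ → Bool

_∈_ : ℕ → Subset → Set
n ∈ A = A n ≡ true

_⊆_ : Subset → Subset → Set
A ⊆ B = ∀ n → n ∈ A → n ∈ B

_∖_ : Subset → Subset → Subset
(A ∖ B) n = A n ∧ not (B n)

compl : Subset → Subset
compl A n = not (A n)

countBelow : Subset → ℕ → ℕ
countBelow A zero = zero
countBelow A (suc N) = countBelow A N + (if A N then 1 else 0)

HasCard : Subset → ℕ → Set
HasCard A k = Σ ℕ λ N → (∀ n → N ≤ n → A n ≡ false) × (countBelow A N ≡ k)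

record NumericalSemigroup (S : Subset) : Set where
  field
    zero∈ : 0 ∈ S
    closed : ∀ a b → a ∈ S → b ∈ S → (a + b) ∈ S
    cofinite : Σ ℕ λ c → ∀ n → c ≤ n → n ∈ S

Genus : Subset → ℕ → Set
Genus S g = HasCard (compl S) g

record Ideal (S I : Subset) : Set where
  field
    sub : I ⊆ S
    absorb : ∀ a s → a ∈ I → s ∈ S → (a + s) ∈ I

-- proper: I ≠ S (given I ⊆ S, some element of S is missing from I)
Proper : Subset → Subset → Set
Proper S I = Σ ℕ λ n → n ∈ S × I n ≡ false

-- f is the Frobenius number of I (largest natural not in I); for a proper
-- ideal 0 ∉ I, so it is a natural number
IsFrobenius : Subset → ℕ → Set
IsFrobenius I f = (I f ≡ false) × (∀ n → f < n → n ∈ I)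

MaxSparse : Subset → Subset → Set
MaxSparse S I = Σ ℕ λ g → Σ ℕ λ k →
  Genus S g × HasCard (S ∖ I) k × IsFrobenius I (2 * g + k ∸ 1)

IsLambda : Subset → ℕ → ℕ → Set
IsLambda S i l = (l ∈ S) × (countBelow S l ≡ i)

-- D(i) for λ_i = l : { s ∈ S : l - s ∈ S }
D : Subset → ℕ → Subset
D S l n = S n ∧ (if n ≤ᵇ l then S (l ∸ n) else false)

G : Subset → ℕ → ℕ
G S l = countBelow (λ a → not (S a) ∧ not (S (l ∸ a))) (suc l)

IsLeader : Subset → Subset → ℕ → ℕ → Set
IsLeader S I i l = IsLambda S i l × (G S l ≡ 0) × (∀ n → I n ≡ (S ∖ D S l) n)

-- Under I = S ∖ D(λ_i) the complement S ∖ I is the set D(λ_i) of summands of the leader, so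
-- (1) ⇔ (3) is complementation inside S, and D(λ_{i'}) ⊆ D(λ_i) ⇔ λ_i − λ_{i'} ∈ S because
-- λ_{i'} ∈ D(λ_{i'}) and S is additively closed. For (4), a maximum sparse ideal has
-- Frobenius number exactly its leader: λ_i ∉ I bounds it from below, and anything above λ_i
-- outside I would be a gap ≥ 2g, whereas every gap x has x < 2g (the map a ↦ x − a sends
-- S ∩ [0, x] into the gaps). Hence λ_i + 1 = 2g + #(S ∖ I), and (2) ⇔ (4) is a translation.
module Submission where

open import Defs
open import Data.Bool using (true; false; _∧_; not; if_then_else_)
open import Data.Bool.Properties using (T-≡; ∧-zeroʳ)
open import Data.Empty using (⊥-elim)
open import Data.Nat using (ℕ; zero; suc; _+_; _*_; _∸_; _≤_; _<_; _≤′_; ≤′-refl; ≤′-step; _≤ᵇ_; _⊔_; z≤n; s≤s; s≤s⁻¹; >-nonZero)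
open import Data.Nat.Properties
open import Data.Product using (Σ; _×_; _,_; proj₁; proj₂)
open import Data.Sum using (_⊎_; inj₁; inj₂)
open import Function.Bundles using (_⇔_; mk⇔; Equivalence)
open import Function.Properties.Equivalence using () renaming (trans to ⇔-trans; sym to ⇔-sym)
open import Relation.Binary.PropositionalEquality

private
  variable
    A B A' B' S : Subset
    k k' m n N : ℕ

true≢false : true ≢ false
true≢false ()

∈-∖ : n ∈ A → B n ≡ false → n ∈ (A ∖ B)
∈-∖ {n} {A} {B} a b rewrite a | b = refl

∈-∖⁻ : n ∈ (A ∖ B) → n ∈ A × B n ≡ false
∈-∖⁻ {n} {A} {B} e with A n | B n
... | true | false = refl , refl

∉-∖⁻ : (A ∖ B) n ≡ false → A n ≡ false ⊎ n ∈ B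
∉-∖⁻ {A} {B} {n} e with A n | B n
... | false | _ = inj₁ refl
... | true | true = inj₂ refl

∉-⊆ : A ⊆ B → B n ≡ false → A n ≡ false
∉-⊆ {A} {B} {n} A⊆B b with A n in a
... | false = refl
... | true = ⊥-elim (true≢false (trans (sym (A⊆B n a)) b))

⊆-cong : A ≗ A' → B ≗ B' → (A ⊆ B) ⇔ (A' ⊆ B')
⊆-cong A≗A' B≗B' = mk⇔
  (λ A⊆B n a → trans (sym (B≗B' n)) (A⊆B n (trans (A≗A' n) a)))
  (λ A'⊆B' n a → trans (B≗B' n) (A'⊆B' n (trans (sym (A≗A' n)) a)))

∖-⊆⇔ : A ⊆ S → (A ⊆ B) ⇔ ((S ∖ B) ⊆ (S ∖ A))
∖-⊆⇔ {A} {S} {B} A⊆S = mk⇔ to from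
  where
    to : A ⊆ B → (S ∖ B) ⊆ (S ∖ A)
    to A⊆B n e = let (s , b) = ∈-∖⁻ {n = n} {S} {B} e in ∈-∖ {n = n} {S} {A} s (∉-⊆ A⊆B b)
    from : (S ∖ B) ⊆ (S ∖ A) → A ⊆ B
    from h n a with B n in b
    ... | true = refl
    ... | false = ⊥-elim (true≢false (trans (sym a) (proj₂ (∈-∖⁻ {n = n} {S} {A} (h n (∈-∖ {n = n} {S} {B} (A⊆S n a) b))))))

countBelow-cong : ∀ A B n → (∀ a → a < n → A a ≡ B a) → countBelow A n ≡ countBelow B n
countBelow-cong A B zero h = refl
countBelow-cong A B (suc n) h =
  cong₂ _+_ (countBelow-cong A B n (λ a a<n → h a (m<n⇒m<1+n a<n))) (cong (λ b → if b then 1 else 0) (h n ≤-refl))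

countBelow-mono : ∀ A B n → (∀ a → a < n → a ∈ A → a ∈ B) → countBelow A n ≤ countBelow B n
countBelow-mono A B zero h = z≤n
countBelow-mono A B (suc n) h =
  +-mono-≤ (countBelow-mono A B n (λ a a<n → h a (m<n⇒m<1+n a<n))) (indicator-mono (h n ≤-refl))
  where
    indicator-mono : (A n ≡ true → B n ≡ true) → (if A n then 1 else 0) ≤ (if B n then 1 else 0)
    indicator-mono h with A n | B n
    ... | false | _ = z≤n
    ... | true | true = ≤-refl
    ... | true | false = ⊥-elim (true≢false (sym (h refl)))

countBelow-monoʳ : ∀ A → m ≤′ n → countBelow A m ≤ countBelow A n
countBelow-monoʳ A ≤′-refl = ≤-refl
countBelow-monoʳ A (≤′-step m≤′n) = ≤-trans (countBelow-monoʳ A m≤′n) (m≤m+n _ _)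

countBelow-stable : ∀ A → (∀ n → N ≤ n → A n ≡ false) → N ≤′ m → countBelow A m ≡ countBelow A N
countBelow-stable A vanish ≤′-refl = refl
countBelow-stable {m = suc m} A vanish (≤′-step N≤′m)
  rewrite vanish m (≤′⇒≤ N≤′m) = trans (+-identityʳ _) (countBelow-stable A vanish N≤′m)

countBelow-sucˡ : ∀ A n → countBelow A (suc n) ≡ (if A 0 then 1 else 0) + countBelow (λ a → A (suc a)) n
countBelow-sucˡ A zero = +-comm 0 _
countBelow-sucˡ A (suc n) =
  trans (cong (_+ (if A (suc n) then 1 else 0)) (countBelow-sucˡ A n))
        (+-assoc (if A 0 then 1 else 0) (countBelow (λ a → A (suc a)) n) _)

countBelow-reverse : ∀ A n → countBelow (λ a → A (n ∸ a)) (suc n) ≡ countBelow A (suc n)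
countBelow-reverse A zero = refl
countBelow-reverse A (suc n) = begin
    countBelow (λ a → A (suc n ∸ a)) (suc n) + (if A (n ∸ n) then 1 else 0)
  ≡⟨ cong₂ _+_ (countBelow-cong _ _ (suc n) (λ a a≤n → cong A (+-∸-assoc 1 (s≤s⁻¹ a≤n))))
               (cong (λ x → if A x then 1 else 0) (n∸n≡0 n)) ⟩
    countBelow (λ a → A (suc (n ∸ a))) (suc n) + (if A 0 then 1 else 0)
  ≡⟨ cong (_+ (if A 0 then 1 else 0)) (countBelow-reverse (λ a → A (suc a)) n) ⟩
    countBelow (λ a → A (suc a)) (suc n) + (if A 0 then 1 else 0)
  ≡⟨ +-comm (countBelow (λ a → A (suc a)) (suc n)) _ ⟩
    (if A 0 then 1 else 0) + countBelow (λ a → A (suc a)) (suc n)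
  ≡⟨ countBelow-sucˡ A (suc n) ⟨
    countBelow A (suc (suc n))
  ∎
  where open ≡-Reasoning

countBelow-+-compl : ∀ A n → countBelow A n + countBelow (compl A) n ≡ n
countBelow-+-compl A zero = refl
countBelow-+-compl A (suc n) with A n
... | true = begin
    (countBelow A n + 1) + (countBelow (compl A) n + 0)
  ≡⟨ cong₂ _+_ (+-comm (countBelow A n) 1) (+-identityʳ (countBelow (compl A) n)) ⟩
    suc (countBelow A n + countBelow (compl A) n)
  ≡⟨ cong suc (countBelow-+-compl A n) ⟩
    suc n
  ∎
  where open ≡-Reasoning
... | false = begin
    (countBelow A n + 0) + (countBelow (compl A) n + 1)
  ≡⟨ cong₂ _+_ (+-identityʳ (countBelow A n)) (+-comm (countBelow (compl A) n) 1) ⟩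
    countBelow A n + suc (countBelow (compl A) n)
  ≡⟨ +-suc (countBelow A n) (countBelow (compl A) n) ⟩
    suc (countBelow A n + countBelow (compl A) n)
  ≡⟨ cong suc (countBelow-+-compl A n) ⟩
    suc n
  ∎
  where open ≡-Reasoning

HasCard⇒countBelow : ∀ A → (card : HasCard A k) → proj₁ card ≤ m → countBelow A m ≡ k
HasCard⇒countBelow A (N , vanish , count) N≤m = trans (countBelow-stable A vanish (≤⇒≤′ N≤m)) count

countBelow≤card : ∀ A n → HasCard A k → countBelow A n ≤ k
countBelow≤card A n card@(N , _) = begin
  countBelow A n       ≤⟨ countBelow-monoʳ A (≤⇒≤′ (m≤m⊔n n N)) ⟩
  countBelow A (n ⊔ N) ≡⟨ HasCard⇒countBelow A card (m≤n⊔m n N) ⟩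
  _                    ∎
  where open ≤-Reasoning

HasCard-unique : ∀ A → HasCard A k → HasCard A k' → k ≡ k'
HasCard-unique A card@(N , _) card'@(N' , _) =
  trans (sym (HasCard⇒countBelow A card (m≤m⊔n N N'))) (HasCard⇒countBelow A card' (m≤n⊔m N N'))

∈⇒HasCard-pos : ∀ A → n ∈ A → HasCard A k → 1 ≤ k
∈⇒HasCard-pos {n} A n∈A card = ≤-trans one≤count (countBelow≤card A (suc n) card)
  where
    one≤count : 1 ≤ countBelow A (suc n)
    one≤count rewrite n∈A = m≤n+m 1 _

gap<2*genus : ∀ {g x} → NumericalSemigroup S → Genus S g → S x ≡ false → x < 2 * g
gap<2*genus {S} {g} {x} ns genus x∉S = begin
  suc x                         ≡⟨ countBelow-+-compl S (suc x) ⟨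
  #elements + #gaps             ≤⟨ +-mono-≤ (≤-trans #elements≤#gaps #gaps≤g) #gaps≤g ⟩
  g + g                         ≡⟨ cong (g +_) (+-identityʳ g) ⟨
  2 * g                         ∎
  where
    open ≤-Reasoning
    open NumericalSemigroup ns
    #elements #gaps : ℕ
    #elements = countBelow S (suc x)
    #gaps = countBelow (compl S) (suc x)
    #gaps≤g : #gaps ≤ g
    #gaps≤g = countBelow≤card (compl S) (suc x) genus
    reflected-is-gap : ∀ a → a < suc x → S (x ∸ a) ≡ true → compl S a ≡ true
    reflected-is-gap a a≤x x-a∈S with S a in a∈S
    ... | false = refl
    ... | true = ⊥-elim (true≢false (trans (sym (subst (_∈ S) (m+[n∸m]≡n (s≤s⁻¹ a≤x)) (closed a (x ∸ a) a∈S x-a∈S))) x∉S))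
    #elements≤#gaps : #elements ≤ #gaps
    #elements≤#gaps = begin
      #elements                              ≡⟨ countBelow-reverse S x ⟨
      countBelow (λ a → S (x ∸ a)) (suc x)   ≤⟨ countBelow-mono _ (compl S) (suc x) reflected-is-gap ⟩
      #gaps                                  ∎

D-intro : ∀ S l n → n ∈ S → n ≤ l → (l ∸ n) ∈ S → n ∈ D S l
D-intro S l n n∈S n≤l l-n∈S rewrite n∈S | Equivalence.to T-≡ (≤⇒≤ᵇ n≤l) = l-n∈S

D-elim : ∀ S l n → n ∈ D S l → n ∈ S × n ≤ l × (l ∸ n) ∈ S
D-elim S l n n∈D with S n | n ≤ᵇ l in n≤ᵇl
... | true | true = refl , ≤ᵇ⇒≤ n l (Equivalence.from T-≡ n≤ᵇl) , n∈D

0∈D : NumericalSemigroup S → ∀ l → l ∈ S → 0 ∈ D S l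
0∈D {S} ns l l∈S = D-intro S l 0 (NumericalSemigroup.zero∈ ns) z≤n l∈S

l∈D : NumericalSemigroup S → ∀ l → l ∈ S → l ∈ D S l
l∈D {S} ns l l∈S = D-intro S l l l∈S ≤-refl (subst (_∈ S) (sym (n∸n≡0 l)) (NumericalSemigroup.zero∈ ns))

D-⊆⇔ : NumericalSemigroup S → ∀ l l' → l' ∈ S → (D S l' ⊆ D S l) ⇔ ((l' ≤ l) × ((l ∸ l') ∈ S))
D-⊆⇔ {S} ns l l' l'∈S = mk⇔ to from
  where
    to : D S l' ⊆ D S l → (l' ≤ l) × ((l ∸ l') ∈ S)
    to D'⊆D = proj₂ (D-elim S l l' (D'⊆D l' (l∈D ns l' l'∈S)))
    from : (l' ≤ l) × ((l ∸ l') ∈ S) → D S l' ⊆ D S l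
    from (l'≤l , l-l'∈S) n n∈D' with D-elim S l' n n∈D'
    ... | n∈S , n≤l' , l'-n∈S = D-intro S l n n∈S (≤-trans n≤l' l'≤l)
      (subst (_∈ S) l-l'+l'-n≡l-n (NumericalSemigroup.closed ns _ _ l-l'∈S l'-n∈S))
      where
        l-l'+l'-n≡l-n : (l ∸ l') + (l' ∸ n) ≡ l ∸ n
        l-l'+l'-n≡l-n = trans (sym (+-∸-assoc (l ∸ l') n≤l')) (cong (_∸ n) (m∸n+n≡m l'≤l))

∖-leader : ∀ S I l → I ≗ S ∖ D S l → S ∖ I ≗ D S l
∖-leader S I l I≗S∖D n =
  trans (cong (λ b → S n ∧ not b) (I≗S∖D n)) (absorb (S n) (D S l n) (λ n∈D → proj₁ (D-elim S l n n∈D)))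
  where
    absorb : ∀ s d → (d ≡ true → s ≡ true) → s ∧ not (s ∧ not d) ≡ d
    absorb true true _ = refl
    absorb true false _ = refl
    absorb false false _ = refl
    absorb false true d⇒s = d⇒s refl

leader≤Frobenius : ∀ {f} → NumericalSemigroup S → ∀ I l → l ∈ S → I ≗ S ∖ D S l → IsFrobenius I f → l ≤ f
leader≤Frobenius {S} ns I l l∈S I≗S∖D (_ , above-f∈I) = ≮⇒≥ λ f<l →
  true≢false (trans (sym (above-f∈I l f<l)) l∉I)
  where
    l∉I : I l ≡ false
    l∉I = proj₂ (∈-∖⁻ {n = l} {S} {I} (trans (∖-leader S I l I≗S∖D l) (l∈D ns l l∈S)))

Frobenius≤leader : ∀ {g f} → NumericalSemigroup S → Genus S g → 2 * g ≤ f →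
  ∀ I l → I ≗ S ∖ D S l → IsFrobenius I f → f ≤ l
Frobenius≤leader {S} {g} {f} ns genus 2g≤f I l I≗S∖D (f∉I , _)
  with ∉-∖⁻ {S} {D S l} {n = f} (trans (sym (I≗S∖D f)) f∉I)
... | inj₁ f∉S = ⊥-elim (<-irrefl refl (<-≤-trans (gap<2*genus ns genus f∉S) 2g≤f))
... | inj₂ f∈D = proj₁ (proj₂ (D-elim S l f f∈D))

suc-leader≡2*genus+card : ∀ {g k} → NumericalSemigroup S → ∀ I l → l ∈ S → I ≗ S ∖ D S l →
  Genus S g → HasCard (S ∖ I) k → IsFrobenius I (2 * g + k ∸ 1) → suc l ≡ 2 * g + k
suc-leader≡2*genus+card {S} {g} {k} ns I l l∈S I≗S∖D genus card frobenius = begin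
  suc l                   ≡⟨ cong suc (≤-antisym l≤f f≤l) ⟩
  suc (2 * g + k ∸ 1)     ≡⟨ suc-pred (2 * g + k) {{>-nonZero (≤-trans 1≤k (m≤n+m k (2 * g)))}} ⟩
  2 * g + k               ∎
  where
    open ≡-Reasoning
    1≤k : 1 ≤ k
    1≤k = ∈⇒HasCard-pos (S ∖ I) (trans (∖-leader S I l I≗S∖D 0) (0∈D ns l l∈S)) card
    l≤f : l ≤ 2 * g + k ∸ 1
    l≤f = leader≤Frobenius ns I l l∈S I≗S∖D frobenius
    f≤l : 2 * g + k ∸ 1 ≤ l
    f≤l = Frobenius≤leader ns genus (≤-trans (m≤m+n (2 * g) (k ∸ 1)) (≤-reflexive (sym (+-∸-assoc (2 * g) 1≤k))))
      I l I≗S∖D frobenius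

≤×∸-translate : ∀ (P : ℕ → Set) c {k k' l l'} → suc l ≡ c + k → suc l' ≡ c + k' →
  ((l' ≤ l) × P (l ∸ l')) ⇔ ((k' ≤ k) × P (k ∸ k'))
≤×∸-translate P c {k} {k'} {l} {l'} eq eq' = mk⇔
  (λ (l'≤l , p) → +-cancelˡ-≤ c k' k (subst₂ _≤_ eq' eq (s≤s l'≤l)) , subst P l-l'≡k-k' p)
  (λ (k'≤k , p) → s≤s⁻¹ (subst₂ _≤_ (sym eq') (sym eq) (+-monoʳ-≤ c k'≤k)) , subst P (sym l-l'≡k-k') p)
  where
    l-l'≡k-k' : l ∸ l' ≡ k ∸ k'
    l-l'≡k-k' = trans (cong₂ _∸_ eq eq') ([m+n]∸[m+o]≡n∸o c k k')

∃-HasCard⇔ : ∀ {Q : ℕ → ℕ → Set} A B → HasCard A k → HasCard B k' →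
  (Σ ℕ λ j → Σ ℕ λ j' → HasCard A j × HasCard B j' × Q j j') ⇔ Q k k'
∃-HasCard⇔ {k} {k'} {Q} A B card card' = mk⇔
  (λ (j , j' , cardj , cardj' , q) → subst₂ Q (HasCard-unique A cardj card) (HasCard-unique B cardj' card') q)
  (λ q → k , k' , card , card' , q)

theorem1 : (S : Subset) → NumericalSemigroup S →
    (I I' : Subset) → Ideal S I → Ideal S I' → Proper S I → Proper S I' →
    MaxSparse S I → MaxSparse S I' →
    (i i' l l' : ℕ) → IsLeader S I i l → IsLeader S I' i' l' →
    ((I ⊆ I') ⇔ ((l' ≤ l) × ((l ∸ l') ∈ S)))
    × ((I ⊆ I') ⇔ ((S ∖ I') ⊆ (S ∖ I)))
    × ((I ⊆ I') ⇔ (Σ ℕ λ k → Σ ℕ λ k' → HasCard (S ∖ I) k × HasCard (S ∖ I') k' × (k' ≤ k) × ((k ∸ k') ∈ S)))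
theorem1 S ns I I' ideal _ _ _ (g , k , genus , card , frobenius) (g' , k' , genus' , card' , frobenius')
  _ _ l l' ((l∈S , _) , _ , I≗S∖D) ((l'∈S , _) , _ , I'≗S∖D') =
  I⊆I'⇔leaders , I⊆I'⇔complements , ⇔-trans I⊆I'⇔leaders (⇔-trans leaders⇔cards (⇔-sym cards))
  where
    I⊆I'⇔complements : (I ⊆ I') ⇔ ((S ∖ I') ⊆ (S ∖ I))
    I⊆I'⇔complements = ∖-⊆⇔ (Ideal.sub ideal)
    I⊆I'⇔leaders : (I ⊆ I') ⇔ ((l' ≤ l) × ((l ∸ l') ∈ S))
    I⊆I'⇔leaders = ⇔-trans I⊆I'⇔complements
      (⇔-trans (⊆-cong (∖-leader S I' l' I'≗S∖D') (∖-leader S I l I≗S∖D)) (D-⊆⇔ ns l l' l'∈S))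
    leaders⇔cards : ((l' ≤ l) × ((l ∸ l') ∈ S)) ⇔ ((k' ≤ k) × ((k ∸ k') ∈ S))
    leaders⇔cards = ≤×∸-translate (_∈ S) (2 * g)
      (suc-leader≡2*genus+card ns I l l∈S I≗S∖D genus card frobenius)
      (trans (suc-leader≡2*genus+card ns I' l' l'∈S I'≗S∖D' genus' card' frobenius')
             (cong (λ h → 2 * h + k') (HasCard-unique (compl S) genus' genus)))
    cards : (Σ ℕ λ j → Σ ℕ λ j' → HasCard (S ∖ I) j × HasCard (S ∖ I') j' × (j' ≤ j) × ((j ∸ j') ∈ S))
            ⇔ ((k' ≤ k) × ((k ∸ k') ∈ S))
    cards = ∃-HasCard⇔ {Q = λ j j' → (j' ≤ j) × ((j ∸ j') ∈ S)} (S ∖ I) (S ∖ I') card card'
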